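{- Given an OP word $w$ on an OP alphabet $(2^{AP},M)$, two POTL formulas $\varphi$ and $\psi$, and a non-empty set $\Pi\subseteq\{\lessdot,\doteq,\gtrdot\}$, for every position $i$ of $w$: $(w,i)\models\varphi\,\mathcal U_\chi^\Pi\,\psi$ if and only if $(w,i)\models\psi\lor\Big(\varphi\land\big(\bigcirc^\Pi(\varphi\,\mathcal U_\chi^\Pi\,\psi)\lor\chi_F^\Pi(\varphi\,\mathcal U_\chi^\Pi\,\psi)\big)\Big)$.
   Context: Let $AP$ be partitioned into normal propositions and structural labels, $\#\notin AP$ an end marker, $\Sigma=2^{AP}$. An operator precedence matrix (OPM) $M$ on $\Sigma$ is a partial function $M:(\Sigma\cup\{\#\})^2\to\{\lessdot,\doteq,\gtrdot\}$, defined only on sets containing exactly one structural label, depending only on structural labels. Write $a\,\pi\,b$ for $M(a,b)=\pi$; by convention $\#\lessdot b$ for every $b$ and $a\gtrdot\#$ for $a\in\Sigma$. A simple chain is $c_0c_1\dots c_\ell c_{\ell+1}$, $\ell\ge1$, $c_0,c_{\ell+1}\in\Sigma\cup\{\#\}$, $c_1..c_\ell\in\Sigma$, $c_0\lessdot c_1\doteq\dots\doteq c_\ell\gtrdot c_{\ell+1}$; a composed chain is $c_0s_0c_1\dots c_\ell s_\ell c_{\ell+1}$ with $c_0c_1\dots c_{\ell+1}$ simple and each $s_k$ empty or with $c_ks_kc_{k+1}$ a chain. $x\in\Sigma^*$ is compatible with $M$ if $M$ is defined on consecutive letters and on the context of every chain substring of $\#x\#$. An OP word is $w=\langle U,M,P\rangle$,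 $U=\{0,\dots,n+1\}$, $P(0)=P(n+1)=\#$, $P(1)\cdots P(n)$ compatible with $M$; $i\,\pi\,j$ means $P(i)\,\pi\,P(j)$; $\chi(i,j)$ iff $i<j-1$ and $P(i)\cdots P(j)$ is a chain. POTL over $AP$: $\varphi::=a\mid\neg\varphi\mid\varphi\lor\varphi\mid\bigcirc^{\Pi}\varphi\mid\ominus^{\Pi}\varphi\mid\chi_F^{\Pi}\varphi\mid\chi_P^{\Pi}\varphi\mid\varphi\,\mathcal U_\chi^{\Pi}\,\varphi\mid\varphi\,\mathcal S_\chi^{\Pi}\,\varphi\mid\bigcirc_H^{\mu}\varphi\mid\ominus_H^{\mu}\varphi\mid\varphi\,\mathcal U_H^{\mu}\,\varphi\mid\varphi\,\mathcal S_H^{\mu}\,\varphi$, $\Pi\subseteq\{\lessdot,\doteq,\gtrdot\}$ nonempty, $\mu\in\{\lessdot,\gtrdot\}$. Semantics at $i$: $a$ iff $a\in P(i)$; Booleans usual. $\bigcirc^\Pi\varphi$: $i\,\pi\,(i+1)$ for some $\pi\in\Pi$ and $\varphi$ at $i+1$. $\ominus^\Pi\varphi$: $(i-1)\,\pi\,i$, $\pi\in\Pi$, $\varphi$ at $i-1$. $\chi_F^\Pi\varphi$: some $j>i$ with $\chi(i,j)$, $i\,\pi\,j$ ($\pi\in\Pi$), $\varphi$ at $j$. $\chi_P^\Pi\varphi$: some $j<i$ with $\chi(j,i)$, $j\,\pi\,i$ ($\pi\in\Pi$), $\varphi$ at $j$. $\bigcirc_H^\lessdot\varphi$: some $h<i$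 has $\chi(h,i)$, $h\lessdot i$, $\{k>i:\chi(h,k),h\lessdot k\}\ne\emptyset$, $\varphi$ at its minimum; $\ominus_H^\lessdot$: $\{k<i:\chi(h,k),h\lessdot k\}$, maximum; $\bigcirc_H^\gtrdot\varphi$: some $h>i$ has $\chi(i,h)$, $i\gtrdot h$, $\{k>i:\chi(k,h),k\gtrdot h\}\ne\emptyset$, $\varphi$ at its minimum; $\ominus_H^\gtrdot$: $\{k<i:\chi(k,h),k\gtrdot h\}$, maximum. A path from $i$ to $j$ is $i=i_1<\dots<i_n=j$ ($n\ge1$). $\varphi\,\mathcal U_\chi^\Pi\,\psi$ holds at $i$ iff for some $j\ge i$ there is a summary path for $\Pi$ from $i$ to $j$ with $\varphi$ at $i_1,\dots,i_{n-1}$ and $\psi$ at $i_n$, where a summary path for $\Pi$ from $i$ to $j$ is a path $i=i_1<\dots<i_n=j$ such that for each $p<n$: if $K_p=\{h\le j:\chi(i_p,h)\text{ and }i_p\,\pi\,h\text{ for some }\pi\in\Pi\}$ is nonempty then $i_{p+1}=\max K_p$, otherwise $i_{p+1}=i_p+1$ and $i_p\,\pi\,(i_p+1)$ for some $\pi\in\Pi$. (The remaining until/since operators are defined analogously on their own path sets.) -}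

module Defs where

open import Data.Nat using (ℕ; zero; suc; _≤_; _<_)
open import Data.Bool using (Bool; T)
open import Data.Maybe using (Maybe; just; nothing)
open import Data.List using (List; []; _∷_; length)
open import Data.List.Membership.Propositional using (_∈_)
open import Data.Product using (Σ; ∃; _×_; _,_)
open import Data.Sum using (_⊎_)
open import Data.Empty using (⊥)
open import Relation.Nullary using (¬_)
open import Relation.Binary.Definitions using (DecidableEquality)
open import Relation.Binary.PropositionalEquality using (_≡_)

data Prec : Set where
  ⋖ ≐ ⋗ : Prec

-- The OPM is given through Mₛ on structural labels: M(a,b) = π iff a and b
-- each contain exactly one structural label s, t and Mₛ s t = just π.
-- Hence M is defined only on sets containing exactly one structural label
-- and depends only on the structural labels.

record OPAlphabet : Set₁ where
  field
    AP         : Set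
    _≟AP_      : DecidableEquality AP
    enum       : List AP
    complete   : ∀ p → p ∈ enum
    structural : AP → Bool
    Mₛ         : AP → AP → Maybe Prec

module _ (A : OPAlphabet) where
  open OPAlphabet A

  Letter : Set
  Letter = AP → Bool

  -- Σ ∪ {#}, with nothing = #
  ExtLetter : Set
  ExtLetter = Maybe Letter

  UniqueStruct : Letter → AP → Set
  UniqueStruct a s = T (structural s) × T (a s) ×
                     (∀ t → T (structural t) → T (a t) → t ≡ s)

  MRel : Letter → Prec → Letter → Set
  MRel a π b = Σ AP λ s → Σ AP λ t →
               UniqueStruct a s × UniqueStruct b t × Mₛ s t ≡ just π

  -- M on Σ ∪ {#}, with the conventions # ⋖ b and a ⋗ #
  PrecE : ExtLetter → Prec → ExtLetter → Set
  PrecE nothing  π b        = π ≡ ⋖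
  PrecE (just a) π nothing  = π ≡ ⋗
  PrecE (just a) π (just b) = MRel a π b

  DefinedM : ExtLetter → ExtLetter → Set
  DefinedM a b = ∃ λ π → PrecE a π b

  IsLetter : ExtLetter → Set
  IsLetter x = ∃ λ a → x ≡ just a

  -- Chain i j : lab i ⋯ lab j is a (simple or composed) chain
  --   c₀ s₀ c₁ … c_ℓ s_ℓ c_{ℓ+1}, with c₀ = i, c_{ℓ+1} = j, ℓ ≥ 1,
  --   c₀ ⋖ c₁ ≐ … ≐ c_ℓ ⋗ c_{ℓ+1}, c₁ … c_ℓ ∈ Σ, and each s_k either empty
  --   (c_{k+1} = c_k + 1) or c_k s_k c_{k+1} a chain.

  data Chain (lab : ℕ → ExtLetter) : ℕ → ℕ → Set
  data Rest  (lab : ℕ → ExtLetter) : ℕ → ℕ → Set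
  data Gap   (lab : ℕ → ExtLetter) : ℕ → ℕ → Set

  data Chain lab where
    chain : ∀ {i c j} → i < c → IsLetter (lab c) → PrecE (lab i) ⋖ (lab c) →
            Gap lab i c → Rest lab c j → Chain lab i j

  data Rest lab where
    last : ∀ {c j} → c < j → PrecE (lab c) ⋗ (lab j) → Gap lab c j → Rest lab c j
    next : ∀ {c d j} → c < d → IsLetter (lab d) → PrecE (lab c) ≐ (lab d) →
           Gap lab c d → Rest lab d j → Rest lab c j

  data Gap lab where
    adj : ∀ {a b} → b ≡ suc a → Gap lab a b
    sub : ∀ {a b} → Chain lab a b → Gap lab a b

  nth : List Letter → ℕ → Maybe Letter
  nth []       _       = nothing
  nth (x ∷ xs) zero    = just x
  nth (x ∷ xs) (suc k) = nth xs k

  -- P(0) = #, P(k) = k-th letter for 1 ≤ k ≤ n, P(n+1) = #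
  labOf : List Letter → ℕ → ExtLetter
  labOf xs zero    = nothing
  labOf xs (suc k) = nth xs k

  Compatible : List Letter → Set
  Compatible xs =
    (∀ k → 1 ≤ k → suc k ≤ length xs → DefinedM (labOf xs k) (labOf xs (suc k))) ×
    (∀ i j → j ≤ suc (length xs) → Chain (labOf xs) i j →
       DefinedM (labOf xs i) (labOf xs j))

  record OPWord : Set where
    field
      letters    : List Letter
      compatible : Compatible letters

  record PiSet : Set where
    field
      mem      : Prec → Bool
      nonempty : ∃ λ π → T (mem π)

  data Dir : Set where
    μ⋖ μ⋗ : Dir

  data Formula : Set where
    atom  : AP → Formula
    ¬ᶠ_   : Formula → Formula
    _∨ᶠ_  : Formula → Formula → Formula
    _∧ᶠ_  : Formula → Formula → Formula
    ○     : PiSet → Formula → Formula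
    ⊖     : PiSet → Formula → Formula
    χF    : PiSet → Formula → Formula
    χP    : PiSet → Formula → Formula
    Uχ    : PiSet → Formula → Formula → Formula
    Sχ    : PiSet → Formula → Formula → Formula
    ○H    : Dir → Formula → Formula
    ⊖H    : Dir → Formula → Formula
    UH    : Dir → Formula → Formula → Formula
    SH    : Dir → Formula → Formula → Formula

  -- forward path i = i₁ < … < i_n = j : φ at i₁ … i_{n-1}, ψ at j
  data UPath (Step : ℕ → ℕ → Set) (P Q : ℕ → Set) (j : ℕ) : ℕ → Set where
    here  : Q j → UPath Step P Q j j
    there : ∀ {a b} → a < b → Step a b → P a → UPath Step P Q j b → UPath Step P Q j a

  -- backward path j = i₁ < … < i_n = i : ψ at j, φ at i₂ … i_n
  data DPath (Step : ℕ → ℕ → Set) (P Q : ℕ → Set) (j : ℕ) : ℕ → Set where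
    start : Q j → DPath Step P Q j j
    more  : ∀ {a b} → a < b → Step a b → P b → DPath Step P Q j a → DPath Step P Q j b

  module _ (w : OPWord) where
    open OPWord w

    len : ℕ
    len = length letters

    P : ℕ → ExtLetter
    P = labOf letters

    Pos : ℕ → Set
    Pos k = k ≤ suc len

    Pr : ℕ → Prec → ℕ → Set
    Pr i π j = PrecE (P i) π (P j)

    PiRel : PiSet → ℕ → ℕ → Set
    PiRel Π i j = ∃ λ π → T (PiSet.mem Π π) × Pr i π j

    χ : ℕ → ℕ → Set
    χ i j = suc i < j × Chain P i j

    HasProp : ExtLetter → AP → Set
    HasProp nothing  p = ⊥
    HasProp (just a) p = T (a p)

    InK : PiSet → ℕ → ℕ → ℕ → Set
    InK Π j a h = h ≤ j × χ a h × PiRel Π a h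

    SumStep : PiSet → ℕ → ℕ → ℕ → Set
    SumStep Π j a b =
      (InK Π j a b × (∀ h → InK Π j a h → h ≤ b)) ⊎
      ((∀ h → ¬ InK Π j a h) × b ≡ suc a × PiRel Π a (suc a))

    InL : PiSet → ℕ → ℕ → ℕ → Set
    InL Π j b h = j ≤ h × χ h b × PiRel Π h b

    BackStep : PiSet → ℕ → ℕ → ℕ → Set
    BackStep Π j a b =
      (InL Π j b a × (∀ h → InL Π j b h → a ≤ h)) ⊎
      ((∀ h → ¬ InL Π j b h) × b ≡ suc a × PiRel Π a b)

    InSL : ℕ → ℕ → Set
    InSL h k = χ h k × Pr h ⋖ k

    InSG : ℕ → ℕ → Set
    InSG h k = χ k h × Pr k ⋗ h

    HStep : (ℕ → ℕ → Set) → ℕ → ℕ → ℕ → Set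
    HStep S h a b = S h a × S h b × (∀ k → a < k → k < b → ¬ S h k)

    sat : Formula → ℕ → Set
    sat (atom p) i = HasProp (P i) p
    sat (¬ᶠ φ) i = ¬ sat φ i
    sat (φ ∨ᶠ ψ) i = sat φ i ⊎ sat ψ i
    sat (φ ∧ᶠ ψ) i = sat φ i × sat ψ i
    sat (○ Π φ) i = Pos (suc i) × PiRel Π i (suc i) × sat φ (suc i)
    sat (⊖ Π φ) i = ∃ λ k → i ≡ suc k × PiRel Π k i × sat φ k
    sat (χF Π φ) i = ∃ λ j → Pos j × i < j × χ i j × PiRel Π i j × sat φ j
    sat (χP Π φ) i = ∃ λ j → j < i × χ j i × PiRel Π j i × sat φ j
    sat (Uχ Π φ ψ) i =
      ∃ λ j → i ≤ j × Pos j × UPath (SumStep Π j) (sat φ) (sat ψ) j i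
    sat (Sχ Π φ ψ) i =
      ∃ λ j → j ≤ i × DPath (BackStep Π j) (sat φ) (sat ψ) j i
    sat (○H μ⋖ φ) i =
      ∃ λ h → h < i × InSL h i ×
        (∃ λ k → Pos k × i < k × InSL h k ×
           (∀ k′ → i < k′ → InSL h k′ → k ≤ k′) × sat φ k)
    sat (⊖H μ⋖ φ) i =
      ∃ λ h → h < i × InSL h i ×
        (∃ λ k → k < i × InSL h k ×
           (∀ k′ → k′ < i → InSL h k′ → k′ ≤ k) × sat φ k)
    sat (○H μ⋗ φ) i =
      ∃ λ h → i < h × Pos h × InSG h i ×
        (∃ λ k → i < k × InSG h k ×
           (∀ k′ → i < k′ → InSG h k′ → k ≤ k′) × sat φ k)
    sat (⊖H μ⋗ φ) i =
      ∃ λ h → i < h × Pos h × InSG h i ×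
        (∃ λ k → k < i × InSG h k ×
           (∀ k′ → k′ < i → InSG h k′ → k′ ≤ k) × sat φ k)
    sat (UH μ⋖ φ ψ) i =
      ∃ λ h → h < i × InSL h i ×
        (∃ λ j → i ≤ j × Pos j × UPath (HStep InSL h) (sat φ) (sat ψ) j i)
    sat (SH μ⋖ φ ψ) i =
      ∃ λ h → h < i × InSL h i ×
        (∃ λ j → j ≤ i × DPath (HStep InSL h) (sat φ) (sat ψ) j i)
    sat (UH μ⋗ φ ψ) i =
      ∃ λ h → i < h × Pos h × InSG h i ×
        (∃ λ j → i ≤ j × Pos j × UPath (HStep InSG h) (sat φ) (sat ψ) j i)
    sat (SH μ⋗ φ ψ) i =
      ∃ λ h → i < h × Pos h × InSG h i ×
        (∃ λ j → j ≤ i × DPath (HStep InSG h) (sat φ) (sat ψ) j i)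

module Submission where

-- Left to right: a summary path either stops at i (ψ holds) or makes a
-- ○^Π- or χ_F^Π-step whose remainder witnesses the until at its target.
-- Right to left we must produce the (forced) first step of a summary path
-- from i: to the greatest h ≤ j with χ(i,h) and i Π h, if any.  It exists
-- since chains are decidable, and the given path from i+1 (resp. from a
-- chain end b) reaches it, because a summary path starting inside a chain
-- (i,m) never jumps over m.  That in turn is the fact that chains never
-- cross, proved from the uniqueness of the top-level structure of chains.

open import Defs
open import Data.Nat using (ℕ; zero; suc; _+_; _≤_; _<_; _≟_; _<?_; _≤?_)
open import Data.Nat.Properties
open import Data.Maybe using (just; nothing)
open import Data.Maybe.Properties using (just-injective; ≡-dec)
import Data.List.Relation.Unary.All as All
import Data.List.Relation.Unary.Any as Any
open import Data.List.Membership.Propositional using (lose)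
open import Data.Product using (Σ; ∃; _×_; _,_; proj₁; proj₂)
open import Data.Sum using (_⊎_; inj₁; inj₂; [_,_]′)
open import Data.Empty using (⊥; ⊥-elim)
open import Relation.Nullary using (¬_; Dec; yes; no)
import Relation.Nullary.Decidable as Dec
open import Relation.Nullary.Decidable using (T?; _×-dec_; _⊎-dec_; _→-dec_)
open import Relation.Binary.Definitions using (DecidableEquality; Tri; tri<; tri≈; tri>)
open import Relation.Binary.PropositionalEquality using (_≡_; _≢_; refl; sym; trans; subst)
open import Function.Base using (id)
open import Function.Bundles using (_⇔_; mk⇔)

greatest? : {Q : ℕ → Set} → (∀ h → Dec (Q h)) → ∀ n → (∀ h → Q h → h ≤ n) →
            (∀ h → ¬ Q h) ⊎ (∃ λ m → Q m × (∀ h → Q h → h ≤ m))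
greatest? {Q} Q? zero bound with Q? zero
... | yes q = inj₂ (zero , q , bound)
... | no ¬q = inj₁ (λ h qh → ¬q (subst Q (n≤0⇒n≡0 (bound h qh)) qh))
greatest? {Q} Q? (suc n) bound with Q? (suc n)
... | yes q = inj₂ (suc n , q , bound)
... | no ¬q = greatest? Q? n (λ h qh → ≤-pred (≤∧≢⇒< (bound h qh) λ { refl → ¬q qh }))

_×-decᵈ_ : {X Y : Set} → Dec X → (X → Dec Y) → Dec (X × Y)
yes x ×-decᵈ Y? = Dec.map′ (x ,_) proj₂ (Y? x)
no ¬x ×-decᵈ _  = no λ { (x , _) → ¬x x }

∃-below? : {Q : ℕ → Set} → ∀ n → (∀ c → c < n → Dec (Q c)) → Dec (∃ λ c → c < n × Q c)
∃-below? n Q? = Dec.map′ (λ { (c , _ , c<n , q) → c , c<n , q })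
                         (λ { (c , c<n , q) → c , c<n , c<n , q })
                         (anyUpTo? (λ c → (c <? n) ×-decᵈ Q? c) n)

_≟ₚ_ : DecidableEquality Prec
⋖ ≟ₚ ⋖ = yes refl
≐ ≟ₚ ≐ = yes refl
⋗ ≟ₚ ⋗ = yes refl
⋖ ≟ₚ ≐ = no λ ()
⋖ ≟ₚ ⋗ = no λ ()
≐ ≟ₚ ⋖ = no λ ()
≐ ≟ₚ ⋗ = no λ ()
⋗ ≟ₚ ⋖ = no λ ()
⋗ ≟ₚ ≐ = no λ ()

∃-prec? : {Q : Prec → Set} → (∀ π → Dec (Q π)) → Dec (∃ Q)
∃-prec? {Q} Q? = Dec.map′ from to (Q? ⋖ ⊎-dec (Q? ≐ ⊎-dec Q? ⋗))
  where
  from : Q ⋖ ⊎ (Q ≐ ⊎ Q ⋗) → ∃ Q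
  from (inj₁ q)        = ⋖ , q
  from (inj₂ (inj₁ q)) = ≐ , q
  from (inj₂ (inj₂ q)) = ⋗ , q
  to : ∃ Q → Q ⋖ ⊎ (Q ≐ ⊎ Q ⋗)
  to (⋖ , q) = inj₁ q
  to (≐ , q) = inj₂ (inj₁ q)
  to (⋗ , q) = inj₂ (inj₂ q)

module _ (A : OPAlphabet) where
  open OPAlphabet A

  ∀-AP? : {Q : AP → Set} → (∀ s → Dec (Q s)) → Dec (∀ s → Q s)
  ∀-AP? Q? = Dec.map′ (λ all s → All.lookup all (complete s))
                      (λ f → All.tabulate (λ {s} _ → f s)) (All.all? Q? enum)

  ∃-AP? : {Q : AP → Set} → (∀ s → Dec (Q s)) → Dec (Σ AP Q)
  ∃-AP? Q? = Dec.map′ Any.satisfied (λ { (s , q) → lose (complete s) q })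
                      (Any.any? Q? enum)

  uniqueStruct? : ∀ a s → Dec (UniqueStruct A a s)
  uniqueStruct? a s =
    T? (structural s) ×-dec T? (a s) ×-dec
    ∀-AP? (λ t → T? (structural t) →-dec (T? (a t) →-dec (t ≟AP s)))

  precE? : ∀ x π y → Dec (PrecE A x π y)
  precE? nothing  π _        = π ≟ₚ ⋖
  precE? (just a) π nothing  = π ≟ₚ ⋗
  precE? (just a) π (just b) =
    ∃-AP? λ s → ∃-AP? λ t →
      uniqueStruct? a s ×-dec uniqueStruct? b t ×-dec ≡-dec _≟ₚ_ (Mₛ s t) (just π)

  isLetter? : ∀ x → Dec (IsLetter A x)
  isLetter? nothing  = no λ { (_ , ()) }
  isLetter? (just a) = yes (a , refl)

  -- A letter has at most one structural label, so M is a function.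
  uniqueStruct-unique : ∀ {a s s′} → UniqueStruct A a s → UniqueStruct A a s′ → s ≡ s′
  uniqueStruct-unique (_ , _ , only-s) (st′ , as′ , _) = sym (only-s _ st′ as′)

  precE-det : ∀ {x y π π′} → PrecE A x π y → PrecE A x π′ y → π ≡ π′
  precE-det {nothing} refl refl = refl
  precE-det {just _} {nothing} refl refl = refl
  precE-det {just _} {just _} (_ , _ , us , ut , e) (_ , _ , us′ , ut′ , e′)
    with uniqueStruct-unique us us′ | uniqueStruct-unique ut ut′
  ... | refl | refl = just-injective (trans (sym e) e′)

  module ChainStructure (lab : ℕ → ExtLetter A) where

    _⟨_⟩_ : ℕ → Prec → ℕ → Set
    x ⟨ π ⟩ y = PrecE A (lab x) π (lab y)

    rest-< : ∀ {c j} → Rest A lab c j → c < j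
    rest-< (last c<j _ _)       = c<j
    rest-< (next c<d _ _ _ rest) = <-trans c<d (rest-< rest)

    chain-< : ∀ {i j} → Chain A lab i j → suc i < j
    chain-< (chain i<c _ _ _ rest) = ≤-<-trans i<c (rest-< rest)

    gap-< : ∀ {x y} → Gap A lab x y → x < y
    gap-< (adj refl) = n<1+n _
    gap-< (sub ch)   = <-trans (n<1+n _) (chain-< ch)

    -- The leftmost innermost chain starts with i ⋖ i+1.
    first-⋖ : ∀ {i j} → Chain A lab i j → i ⟨ ⋖ ⟩ suc i
    first-⋖ (chain _ _ i⋖c (adj refl) _) = i⋖c
    first-⋖ (chain _ _ _ (sub ch) _)     = first-⋖ ch

    top : ∀ {i j} → Chain A lab i j → ℕ
    top (chain {c = c₁} _ _ _ _ _) = c₁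

    top-> : ∀ {i j} (ch : Chain A lab i j) → i < top ch
    top-> (chain i<c₁ _ _ _ _) = i<c₁

    ⋗≢≐ : ⋗ ≢ ≐
    ⋗≢≐ ()

    same-target-prec : ∀ {x f g π π′} → f ≡ g → x ⟨ π ⟩ f → x ⟨ π′ ⟩ g → π ≡ π′
    same-target-prec refl = precE-det

    -- Uniqueness of the top-level structure, by simultaneous induction:
    -- two chains from c ending at e < d satisfy e ≤ c₁ (the first top
    -- position of the longer one) and c ⋖ e; consequently the
    -- non-⋖ steps out of a position, and the tails of chains, are unique.
    top-bound     : ∀ {c e d} → Chain A lab c e → (cd : Chain A lab c d) → e < d → e ≤ top cd
    top-bound-cmp : ∀ {c e d} (ce : Chain A lab c e) (cd : Chain A lab c d) → e < d →
                    Tri (top ce < top cd) (top ce ≡ top cd) (top cd < top ce) → e ≤ top cd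
    top-boundᴳ    : ∀ {c e d} → Gap A lab c e → (cd : Chain A lab c d) → e < d → e ≤ top cd
    endpoint-⋖    : ∀ {c e d} → Chain A lab c e → Chain A lab c d → e < d → c ⟨ ⋖ ⟩ e
    endpoint-⋖ᴳ   : ∀ {c e d} → Chain A lab c e → Gap A lab c d → e < d → c ⟨ ⋖ ⟩ e
    gap-⋖         : ∀ {c e d} → Gap A lab c e → Gap A lab c d → e < d → c ⟨ ⋖ ⟩ e
    gap-unique    : ∀ {x f g π π′} → π ≢ ⋖ → π′ ≢ ⋖ →
                    Gap A lab x f → x ⟨ π ⟩ f → Gap A lab x g → x ⟨ π′ ⟩ g → f ≡ g
    rest-unique   : ∀ {x e d} → Rest A lab x e → Rest A lab x d → e ≡ d
    rest-unique-from : ∀ {f g e d} → f ≡ g → Rest A lab f e → Rest A lab g d → e ≡ d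

    top-bound ce cd e<d = top-bound-cmp ce cd e<d (<-cmp (top ce) (top cd))

    -- Equal first tops: the tails coincide, so e = d.  A later first top
    -- of (c,e), or of (c,d) when d₁ < e, would itself violate the bound.
    top-bound-cmp (chain _ _ _ _ re) (chain _ _ _ _ rd) e<d (tri≈ _ refl _) =
      ⊥-elim (<-irrefl (rest-unique re rd) e<d)
    top-bound-cmp (chain _ _ _ ge re) cd e<d (tri> _ _ d₁<e₁) =
      ⊥-elim (<⇒≱ d₁<e₁ (top-boundᴳ ge cd (<-trans (rest-< re) e<d)))
    top-bound-cmp {e = e} ce (chain {c = d₁} _ _ _ gd _) _ (tri< e₁<d₁ _ _) =
      [ id , (λ d₁<e → ⊥-elim (<⇒≱ e₁<d₁ (top-boundᴳ gd ce d₁<e))) ]′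
      (≤-<-connex e d₁)

    top-boundᴳ (adj refl) cd _   = top-> cd
    top-boundᴳ (sub ce)   cd e<d = top-bound ce cd e<d

    -- e ≤ d₁: either e = d₁, reached by the first step c ⋖ d₁, or e lies
    -- inside the gap s₀ = (c,d₁), which must then be a chain.
    endpoint-⋖ {c} ce cd@(chain _ _ c⋖d₁ gd _) e<d =
      [ (λ e<d₁ → endpoint-⋖ᴳ ce gd e<d₁) , (λ e≡d₁ → subst (c ⟨ ⋖ ⟩_) (sym e≡d₁) c⋖d₁) ]′
      (m≤n⇒m<n∨m≡n (top-bound ce cd e<d))

    endpoint-⋖ᴳ ce (adj refl) e<d = ⊥-elim (<⇒≱ (chain-< ce) (<⇒≤ e<d))
    endpoint-⋖ᴳ ce (sub cd)   e<d = endpoint-⋖ ce cd e<d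

    gap-⋖ ge         (adj refl) e<d = ⊥-elim (<⇒≱ (gap-< ge) (≤-pred e<d))
    gap-⋖ (adj refl) (sub cd)   _   = first-⋖ cd
    gap-⋖ (sub ce)   gd         e<d = endpoint-⋖ᴳ ce gd e<d

    -- If f < g, then x ⋖ f by gap-⋖, so π = ⋖; symmetrically for g < f.
    gap-unique π≢⋖ π′≢⋖ gf x⟨π⟩f gg x⟨π′⟩g = ≤-antisym
      (≮⇒≥ λ g<f → π′≢⋖ (precE-det x⟨π′⟩g (gap-⋖ gg gf g<f)))
      (≮⇒≥ λ f<g → π≢⋖ (precE-det x⟨π⟩f (gap-⋖ gf gg f<g)))

    rest-unique (last _ p g) (last _ q h) = gap-unique (λ ()) (λ ()) g p h q
    rest-unique (last _ p g) (next _ _ q h _) =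
      ⊥-elim (⋗≢≐ (same-target-prec (gap-unique (λ ()) (λ ()) g p h q) p q))
    rest-unique (next _ _ p g _) (last _ q h) =
      ⊥-elim (⋗≢≐ (same-target-prec (gap-unique (λ ()) (λ ()) h q g p) q p))
    rest-unique (next _ _ p g r) (next _ _ q h r′) =
      rest-unique-from (gap-unique (λ ()) (λ ()) g p h q) r r′

    rest-unique-from refl = rest-unique

    -- Chains never cross: a < c < b < d is impossible for chains (a,b), (c,d).
    -- The auxiliary forms walk along the top level of the chain (a,b).
    no-crossing      : ∀ {a b c d} → Chain A lab a b → Chain A lab c d → a < c → c < b → b < d → ⊥
    rest-no-crossing : ∀ {r b c d} → Rest A lab r b → Chain A lab c d → r ≤ c → c < b → b < d → ⊥
    gap-no-crossing  : ∀ {x y c d} → Gap A lab x y → Chain A lab c d → x < c → c < y → y < d → ⊥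
    step-no-crossing : ∀ {r e c d π} → π ≢ ⋖ → Gap A lab r e → r ⟨ π ⟩ e →
                       Chain A lab c d → r ≤ c → c < e → e < d → ⊥

    no-crossing {c = c} (chain {c = c₁} _ _ _ g rest) cd a<c c<b b<d with c <? c₁
    ... | yes c<c₁ = gap-no-crossing g cd a<c c<c₁ (<-trans (rest-< rest) b<d)
    ... | no c≮c₁  = rest-no-crossing rest cd (≮⇒≥ c≮c₁) c<b b<d

    rest-no-crossing (last _ p g) cd r≤c c<b b<d = step-no-crossing (λ ()) g p cd r≤c c<b b<d
    rest-no-crossing {c = c} (next {d = e} _ _ p g rest) cd r≤c c<b b<d with c <? e
    ... | yes c<e = step-no-crossing (λ ()) g p cd r≤c c<e (<-trans (rest-< rest) b<d)
    ... | no c≮e  = rest-no-crossing rest cd (≮⇒≥ c≮e) c<b b<d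

    gap-no-crossing (adj refl) _  x<c c<y _ = <⇒≱ x<c (≤-pred c<y)
    gap-no-crossing (sub ch)   cd x<c c<y y<d = no-crossing ch cd x<c c<y y<d

    step-no-crossing π≢⋖ g r⟨π⟩e cd r≤c c<e e<d with m≤n⇒m<n∨m≡n r≤c
    ... | inj₁ r<c  = gap-no-crossing g cd r<c c<e e<d
    ... | inj₂ refl = π≢⋖ (precE-det r⟨π⟩e (gap-⋖ g (sub cd) e<d))

    nested : ∀ {i h p q} → Chain A lab i h → i < p → p < h → Chain A lab p q → q ≤ h
    nested {h = h} {q = q} ch i<p p<h cq with q ≤? h
    ... | yes q≤h = q≤h
    ... | no q≰h  = ⊥-elim (no-crossing ch cq i<p p<h (≰⇒> q≰h))

  -- Chains are decidable: the components of a chain from i to j span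
  -- strictly shorter intervals, so a fuel n with j ≤ n + i suffices.
  module ChainDecidable (lab : ℕ → ExtLetter A) where
    open ChainStructure lab using (rest-<; chain-<)

    chain-unfold : ∀ {i j} →
      (∃ λ c → c < j × (i < c × IsLetter A (lab c) × PrecE A (lab i) ⋖ (lab c) ×
                        Gap A lab i c × Rest A lab c j)) ⇔ Chain A lab i j
    chain-unfold = mk⇔ (λ { (_ , _ , i<c , l , p , g , r) → chain i<c l p g r })
                       (λ { (chain {c = c} i<c l p g r) → c , rest-< r , i<c , l , p , g , r })

    rest-unfold : ∀ {c j} →
      ((c < j × PrecE A (lab c) ⋗ (lab j) × Gap A lab c j) ⊎
       (∃ λ d → d < j × (c < d × IsLetter A (lab d) × PrecE A (lab c) ≐ (lab d) ×
                         Gap A lab c d × Rest A lab d j))) ⇔ Rest A lab c j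
    rest-unfold = mk⇔ (λ { (inj₁ (c<j , p , g)) → last c<j p g
                         ; (inj₂ (_ , _ , c<d , l , p , g , r)) → next c<d l p g r })
                      (λ { (last c<j p g) → inj₁ (c<j , p , g)
                         ; (next {d = d} c<d l p g r) →
                             inj₂ (d , rest-< r , c<d , l , p , g , r) })

    gap-unfold : ∀ {a b} → (b ≡ suc a ⊎ Chain A lab a b) ⇔ Gap A lab a b
    gap-unfold = mk⇔ (λ { (inj₁ e) → adj e ; (inj₂ ch) → sub ch })
                     (λ { (adj e) → inj₁ e ; (sub ch) → inj₂ ch })

    fuel-shift : ∀ n {c d j} → c < d → j ≤ suc n + c → j ≤ n + d
    fuel-shift n {c} c<d bd = ≤-trans bd (≤-trans (≤-reflexive (sym (+-suc n c))) (+-monoʳ-≤ n c<d))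

    chainᶠ? : ∀ n i j → j ≤ n + i → Dec (Chain A lab i j)
    gapᶠ?   : ∀ n a b → b ≤ n + a → Dec (Gap A lab a b)
    restᶠ?  : ∀ n c j → j ≤ n + c → Dec (Rest A lab c j)

    chainᶠ? zero i j bd =
      no λ ch → <⇒≱ (<-trans (n<1+n i) (chain-< ch)) bd
    chainᶠ? (suc n) i j bd = Dec.map chain-unfold (∃-below? j λ c c<j →
      (i <? c) ×-decᵈ λ i<c →
        isLetter? (lab c) ×-dec precE? (lab i) ⋖ (lab c) ×-dec
        gapᶠ? n i c (≤-pred (≤-trans c<j bd)) ×-dec
        restᶠ? n c j (fuel-shift n i<c bd))

    gapᶠ? n a b bd = Dec.map gap-unfold ((b ≟ suc a) ⊎-dec chainᶠ? n a b bd)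

    restᶠ? zero c j bd = no λ r → <⇒≱ (rest-< r) bd
    restᶠ? (suc n) c j bd = Dec.map rest-unfold
      (((c <? j) ×-dec precE? (lab c) ⋗ (lab j) ×-dec gapᶠ? (suc n) c j bd) ⊎-dec
       (∃-below? j λ d d<j →
         (c <? d) ×-decᵈ λ c<d →
           isLetter? (lab d) ×-dec precE? (lab c) ≐ (lab d) ×-dec
           gapᶠ? (suc n) c d (≤-trans (<⇒≤ d<j) bd) ×-dec
           restᶠ? n d j (fuel-shift n c<d bd)))

    chain? : ∀ i j → Dec (Chain A lab i j)
    chain? i j = chainᶠ? j i j (m≤m+n j i)

path-≤ : ∀ {A St Φ Ψ j p} → UPath A St Φ Ψ j p → p ≤ j
path-≤ (here _)           = ≤-refl
path-≤ (there p<b _ _ rest) = <⇒≤ (<-≤-trans p<b (path-≤ rest))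

module SummaryPaths (A : OPAlphabet) (w : OPWord A) (Π : PiSet A) (Φ Ψ : ℕ → Set) where
  open ChainStructure A (P A w) using (nested)

  SumPath : ℕ → ℕ → Set
  SumPath j = UPath A (SumStep A w Π j) Φ Ψ j

  inK? : ∀ j i h → Dec (InK A w Π j i h)
  inK? j i h =
    h ≤? j ×-dec (suc i <? h ×-dec ChainDecidable.chain? A (P A w) i h) ×-dec
    ∃-prec? (λ π → T? (PiSet.mem Π π) ×-dec precE? A (P A w i) π (P A w h))

  step-inside : ∀ {i h j p b} → Chain A (P A w) i h → i < p → p < h →
                SumStep A w Π j p b → b ≤ h
  step-inside ch i<p p<h (inj₁ ((_ , (_ , chain-pb) , _) , _)) = nested ch i<p p<h chain-pb
  step-inside ch i<p p<h (inj₂ (_ , refl , _))                 = p<h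

  path-through : ∀ {i h j p} → Chain A (P A w) i h → i < p → p ≤ h → h ≤ j →
                 SumPath j p → SumPath j h
  path-through ch i<p p≤h h≤j (here ψ) with ≤-antisym p≤h h≤j
  ... | refl = here ψ
  path-through {h = h} {p = p} ch i<p p≤h h≤j path@(there p<b step _ rest) with p ≟ h
  ... | yes refl = path
  ... | no p≢h   = path-through ch (<-trans i<p p<b) (step-inside ch i<p (≤∧≢⇒< p≤h p≢h) step) h≤j rest

  FirstMove : ℕ → ℕ → ℕ → Set
  FirstMove j i b = (b ≡ suc i × PiRel A w Π i (suc i)) ⊎ InK A w Π j i b

  first-move-> : ∀ {j i b} → FirstMove j i b → i < b
  first-move-> (inj₁ (refl , _))           = n<1+n _
  first-move-> (inj₂ (_ , (i+1<b , _) , _)) = <-trans (n<1+n _) i+1<b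

  -- Φ at i and a summary path from a first-move target b yield a summary
  -- path from i: its real first step goes to the greatest element of K_i
  -- (if any), which the path from b reaches by path-through.
  prepend : ∀ {i j b} → Φ i → FirstMove j i b → SumPath j b → SumPath j i
  prepend {i} {j} {b} φi move path with greatest? (inK? j i) j (λ _ k → proj₁ k)
  prepend φi (inj₁ (refl , r)) path | inj₁ none = there (n<1+n _) (inj₂ (none , refl , r)) φi path
  prepend φi (inj₂ k)          path | inj₁ none = ⊥-elim (none _ k)
  prepend {i} {j} {b} φi move path | inj₂ (m , km@(m≤j , (i+1<m , chain-im) , _) , maximal) =
    there (<-trans (n<1+n i) i+1<m) (inj₁ (km , maximal)) φi
          (path-through chain-im (first-move-> move) (b≤m move) m≤j path)
    where
    b≤m : FirstMove j i b → b ≤ m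
    b≤m (inj₁ (refl , _)) = <⇒≤ i+1<m
    b≤m (inj₂ k)          = maximal b k

lemma4 : (A : OPAlphabet) (w : OPWord A) (φ ψ : Formula A) (Π : PiSet A)
         (i : ℕ) → Pos A w i →
         (sat A w (Uχ Π φ ψ) i ⇔
          sat A w (ψ ∨ᶠ (φ ∧ᶠ (○ Π (Uχ Π φ ψ) ∨ᶠ χF Π (Uχ Π φ ψ)))) i)
lemma4 A w φ ψ Π i pos-i = mk⇔ unfold fold
  where
  open SummaryPaths A w Π (sat A w φ) (sat A w ψ)
  U = Uχ Π φ ψ

  unfold : sat A w U i → sat A w (ψ ∨ᶠ (φ ∧ᶠ (○ Π U ∨ᶠ χF Π U))) i
  unfold (_ , _ , _ , here ψi) = inj₁ ψi
  unfold (j , _ , pos-j , there {b = b} i<b step φi rest) = inj₂ (φi , first-step step)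
    where
    pos-b : Pos A w b
    pos-b = ≤-trans (path-≤ rest) pos-j
    U-at-b : sat A w U b
    U-at-b = j , path-≤ rest , pos-j , rest
    first-step : SumStep A w Π j i b → sat A w (○ Π U ∨ᶠ χF Π U) i
    first-step (inj₁ ((_ , χ-ib , r) , _)) = inj₂ (b , pos-b , i<b , χ-ib , r , U-at-b)
    first-step (inj₂ (_ , refl , r))       = inj₁ (pos-b , r , U-at-b)

  fold : sat A w (ψ ∨ᶠ (φ ∧ᶠ (○ Π U ∨ᶠ χF Π U))) i → sat A w U i
  fold (inj₁ ψi) = i , ≤-refl , pos-i , here ψi
  fold (inj₂ (φi , inj₁ (_ , r , (j , i+1≤j , pos-j , path)))) =
    j , <⇒≤ i+1≤j , pos-j , prepend φi (inj₁ (refl , r)) path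
  fold (inj₂ (φi , inj₂ (b , _ , i<b , χ-ib , r , (j , b≤j , pos-j , path)))) =
    j , ≤-trans (<⇒≤ i<b) b≤j , pos-j , prepend φi (inj₂ (b≤j , χ-ib , r)) path
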